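{- Let $n\ge 3$ and consider the $n$-stage binary linear feedback shift register with feedback function $F(x_1,\ldots,x_n)=x_{n-1}+x_n$ over $GF(2)$. Its state diagram has exactly two connected components: $G_1$, containing the loop at $\mathbf{0}^n$, and $G_2$, containing the $3$-cycle on the states $v_1=(0,1,1,0,1,1,\ldots)$, $v_2=(1,1,0,1,1,0,\ldots)$, $v_3=(1,0,1,1,0,1,\ldots)$ (first $n$ terms). Then $G_1\setminus[0]$ (the digraph obtained from $G_1$ by deleting the vertex $\mathbf{0}^n$ and all arcs incident to it) is a perfect binary directed tree of depth $n-3$, and $G_2\setminus[0,1,1]$ (obtained from $G_2$ by deleting $v_1,v_2,v_3$ and all arcs incident to them) consists of three perfect binary directed trees of depth $n-3$.
   Context: An $n$-stage feedback shift register with feedback function $F:GF(2)^n\to GF(2)$ maps a state $(a_1,\ldots,a_n)$ to its successor $(a_2,\ldots,a_n,F(a_1,\ldots,a_n))$; its state diagram is the directed graph on $GF(2)^n$ with an arc from each state to its successor. Deleting a vertex from a digraph removes it together with all arcs incident to it. A perfect binary directed tree of depth $k$ is a directed graph whose underlying undirected graph is a perfect binary tree of depth $k$ with respect to some root (every non-leaf vertex has exactly two children and all leaves are at distance $k$ from the root), so it has $2^{k+1}-1$ vertices; in the present setting arcs are oriented towards the root. -}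

module Defs where

open import Data.Bool using (Bool; true; false; _xor_)
open import Data.Nat using (ℕ; zero; suc; _≤_; _%_; _≡ᵇ_)
open import Data.Fin using (Fin; toℕ)
open import Data.Vec using (Vec; []; _∷_; _∷ʳ_; replicate; tabulate)
open import Data.List using (List; length) renaming (_∷_ to _∷ₗ_)
open import Data.Product using (Σ; ∃; _×_; _,_; proj₁)
open import Data.Fin using (Fin)
open import Relation.Binary.PropositionalEquality using (_≡_; _≢_)
open import Relation.Binary.Construct.Closure.Equivalence using (EqClosure)

State : ℕ → Set
State n = Vec Bool n

-- Feedback function F(x₁,…,xₙ) = x_{n-1} + x_n over GF(2)  (n = 2 + k).
F : ∀ {k} → Vec Bool (suc (suc k)) → Bool
F {zero}  (a ∷ b ∷ []) = a xor b
F {suc k} (a ∷ as)     = F as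

next : ∀ {k} → State (suc (suc k)) → State (suc (suc k))
next (a ∷ as) = as ∷ʳ F (a ∷ as)

Arc : ∀ {k} → State (suc (suc k)) → State (suc (suc k)) → Set
Arc x y = next x ≡ y

Connected : ∀ {k} → State (suc (suc k)) → State (suc (suc k)) → Set
Connected = EqClosure Arc

zeroState : ∀ {n} → State n
zeroState = replicate _ false

-- 0-indexed position i; v₁ = 011011…, v₂ = 110110…, v₃ = 101101…
v₁ v₂ v₃ : ∀ {n} → State n
v₁ = tabulate (λ i → notZ (toℕ i % 3))
  where notZ : ℕ → Bool
        notZ 0 = false
        notZ _ = true
v₂ = tabulate (λ i → notTwo (toℕ i % 3))
  where notTwo : ℕ → Bool
        notTwo 2 = false
        notTwo _ = true
v₃ = tabulate (λ i → notOne (toℕ i % 3))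
  where notOne : ℕ → Bool
        notOne 1 = false
        notOne _ = true

-- Standard perfect binary tree of depth k, arcs oriented towards the root:
-- vertices are binary words of length ≤ k (root = empty word), and the
-- children of w are b ∷ w (b ∈ {0,1}); arc from each child to its parent.
TVert : ℕ → Set
TVert k = Σ (List Bool) (λ w → length w ≤ k)

TArc : ∀ {k} → TVert k → TVert k → Set
TArc u v = ∃ λ (b : Bool) → proj₁ u ≡ b ∷ₗ proj₁ v

Forest3 : ℕ → Set
Forest3 k = Fin 3 × TVert k

FArc : ∀ {k} → Forest3 k → Forest3 k → Set
FArc (i , u) (j , v) = (i ≡ j) × TArc u v

-- Vertices of the
-- induced subdigraph are states (identified up to equality of states).
record InducedIso {k} (P : State (suc (suc k)) → Set)
                  (W : Set) (WArc : W → W → Set) : Set where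
  field
    to       : (x : State (suc (suc k))) → P x → W
    from     : W → State (suc (suc k))
    from-P   : ∀ w → P (from w)
    from-to  : ∀ x (px : P x) → from (to x px) ≡ x
    to-from  : ∀ w (p : P (from w)) → to (from w) p ≡ w
    to-arc   : ∀ x y (px : P x) (py : P y) → Arc x y → WArc (to x px) (to y py)
    from-arc : ∀ u v → WArc u v → Arc (from u) (from v)

IsPerfectBinaryTree : ∀ {k} → (State (suc (suc k)) → Set) → ℕ → Set
IsPerfectBinaryTree P d = InducedIso P (TVert d) TArc

IsThreePerfectBinaryTrees : ∀ {k} → (State (suc (suc k)) → Set) → ℕ → Set
IsThreePerfectBinaryTrees P d = InducedIso P (Forest3 d) FArc

module Submission where

-- Describe a state a₁ ⋯ aₙ by its defect vector eᵢ = aᵢ + aᵢ₊₁ + aᵢ₊₂ (i ≤ n − 2), which records where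
-- the recurrence aᵢ₊₂ = aᵢ + aᵢ₊₁ fails, together with its last two entries (aₙ₋₁, aₙ).  This is a
-- bijection, and in these coordinates the successor map shifts the defect vector one place to the left,
-- filling in 0, and applies (p, q) ↦ (q, p + q) to the pair.  That map fixes (0, 0) and permutes the
-- other three pairs cyclically, which separates the two components; the states with zero defect vector
-- are 0ⁿ, v₁, v₂, v₃.  The left shift kills every vector of GF(2)ⁿ⁻² after n − 2 steps, and its nonzero
-- vectors form a perfect binary tree of depth n − 3 rooted at 10⋯0: the parent of b w 1 0⋯0 is w 1 0⋯0.
-- In G₂ the three trees are told apart by the pair of the cycle state each one hangs from.

open import Data.Bool using (Bool; true; false; _xor_; if_then_else_)
open import Data.Bool.Properties using (xor-assoc; xor-same; xor-identityʳ)
open import Data.Empty using (⊥-elim)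
open import Data.Fin using (Fin) renaming (zero to fzero; suc to fsuc)
open import Data.List using (List; length) renaming (_∷_ to _∷ₗ_; [] to []ₗ)
open import Data.Nat using (ℕ; zero; suc; _≤_; z≤n; s≤s)
open import Data.Nat.GeneralisedArithmetic using (iterate)
open import Data.Nat.Properties using (≤-irrelevant)
open import Data.Product using (Σ; _×_; _,_; proj₁)
open import Data.Sum using (_⊎_; inj₁; inj₂)
open import Data.Vec using (Vec; []; _∷_; _∷ʳ_; replicate; head; lookup)
open import Function using (_∘_)
open import Relation.Binary.Construct.Closure.Equivalence as EqClosure using ()
open import Relation.Binary.Construct.Closure.ReflexiveTransitive using (ε; _◅_; _◅◅_)
open import Relation.Binary.Construct.Closure.Symmetric using (fwd; bwd)
open import Relation.Binary.PropositionalEquality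
open import Relation.Nullary using (¬_)

open import Defs

xor-cancelʳ : ∀ a b → (a xor b) xor b ≡ a
xor-cancelʳ a b = begin
  (a xor b) xor b  ≡⟨ xor-assoc a b b ⟩
  a xor (b xor b)  ≡⟨ cong (a xor_) (xor-same b) ⟩
  a xor false      ≡⟨ xor-identityʳ a ⟩
  a                ∎
  where open ≡-Reasoning

iterate-natural : ∀ {a b} {A : Set a} {B : Set b} {f : A → A} {g : B → B} (h : A → B) →
                  (∀ x → h (f x) ≡ g (h x)) → ∀ n x → h (iterate f x n) ≡ iterate g (h x) n
iterate-natural h comm zero    x = refl
iterate-natural {f = f} {g} h comm (suc n) x =
  trans (iterate-natural h comm n (f x)) (cong (λ y → iterate g y n) (comm x))

iterate-invariant : ∀ {a b} {A : Set a} {B : Set b} {f : A → A} (h : A → B) →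
                    (∀ x → h (f x) ≡ h x) → ∀ n x → h (iterate f x n) ≡ h x
iterate-invariant h inv zero    x = refl
iterate-invariant {f = f} h inv (suc n) x = trans (iterate-invariant h inv n (f x)) (inv x)

iterate-inverse : ∀ {a} {A : Set a} {f g : A → A} →
                  (∀ x → f (g x) ≡ x) → (∀ x → g (f x) ≡ x) → ∀ n x → iterate f (iterate g x n) n ≡ x
iterate-inverse fg gf zero    x = refl
iterate-inverse {f = f} {g} fg gf (suc n) x = begin
  iterate f (f (iterate g (g x) n)) n  ≡⟨ cong (λ y → iterate f y n) (iterate-natural f commute n (g x)) ⟩
  iterate f (iterate g (f (g x)) n) n  ≡⟨ cong (λ y → iterate f (iterate g y n) n) (fg x) ⟩
  iterate f (iterate g x n) n          ≡⟨ iterate-inverse fg gf n x ⟩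
  x                                    ∎
  where
    open ≡-Reasoning
    commute : ∀ y → f (g y) ≡ g (f y)
    commute y = trans (fg y) (sym (gf y))

Pair : Set
Pair = Bool × Bool

fib : Pair → Pair
fib (p , q) = q , p xor q

fib⁻¹ : Pair → Pair
fib⁻¹ = fib ∘ fib

fib³≡id : ∀ c → fib (fib (fib c)) ≡ c
fib³≡id (false , false) = refl
fib³≡id (false , true)  = refl
fib³≡id (true  , false) = refl
fib³≡id (true  , true)  = refl

fib-iterate-fib⁻¹ : ∀ n c → fib (iterate fib⁻¹ c (suc n)) ≡ iterate fib⁻¹ c n
fib-iterate-fib⁻¹ n c =
  trans (iterate-natural fib (λ _ → refl) n (fib⁻¹ c)) (cong (λ d → iterate fib⁻¹ d n) (fib³≡id c))

isZero : Pair → Bool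
isZero (false , false) = true
isZero (false , true)  = false
isZero (true  , _)     = false

isZero⇒≡00 : ∀ {c} → isZero c ≡ true → c ≡ (false , false)
isZero⇒≡00 {false , false} _ = refl

isZero-fib : ∀ c → isZero (fib c) ≡ isZero c
isZero-fib (false , false) = refl
isZero-fib (false , true)  = refl
isZero-fib (true  , false) = refl
isZero-fib (true  , true)  = refl

isZero-fib⁻¹ : ∀ c → isZero (fib⁻¹ c) ≡ isZero c
isZero-fib⁻¹ c = trans (isZero-fib (fib c)) (isZero-fib c)

fib-orbit : ∀ {c d} → isZero c ≡ false → isZero d ≡ false → d ≡ c ⊎ d ≡ fib c ⊎ d ≡ fib (fib c)
fib-orbit {false , true}  {false , true}  _ _ = inj₁ refl
fib-orbit {false , true}  {true  , true}  _ _ = inj₂ (inj₁ refl)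
fib-orbit {false , true}  {true  , false} _ _ = inj₂ (inj₂ refl)
fib-orbit {true  , true}  {true  , true}  _ _ = inj₁ refl
fib-orbit {true  , true}  {true  , false} _ _ = inj₂ (inj₁ refl)
fib-orbit {true  , true}  {false , true}  _ _ = inj₂ (inj₂ refl)
fib-orbit {true  , false} {true  , false} _ _ = inj₁ refl
fib-orbit {true  , false} {false , true}  _ _ = inj₂ (inj₁ refl)
fib-orbit {true  , false} {true  , true}  _ _ = inj₂ (inj₂ refl)

cyclePair : Fin 3 → Pair
cyclePair fzero               = false , true
cyclePair (fsuc fzero)        = true  , true
cyclePair (fsuc (fsuc fzero)) = true  , false

-- (false , false) is sent to an arbitrary index.
cycleIndex : Pair → Fin 3
cycleIndex (false , false) = fzero
cycleIndex (false , true)  = fzero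
cycleIndex (true  , true)  = fsuc fzero
cycleIndex (true  , false) = fsuc (fsuc fzero)

isZero-cyclePair : ∀ i → isZero (cyclePair i) ≡ false
isZero-cyclePair fzero               = refl
isZero-cyclePair (fsuc fzero)        = refl
isZero-cyclePair (fsuc (fsuc fzero)) = refl

cycleIndex-cyclePair : ∀ i → cycleIndex (cyclePair i) ≡ i
cycleIndex-cyclePair fzero               = refl
cycleIndex-cyclePair (fsuc fzero)        = refl
cycleIndex-cyclePair (fsuc (fsuc fzero)) = refl

cyclePair-cycleIndex : ∀ c → isZero c ≡ false → cyclePair (cycleIndex c) ≡ c
cyclePair-cycleIndex (false , true)  _ = refl
cyclePair-cycleIndex (true  , true)  _ = refl
cyclePair-cycleIndex (true  , false) _ = refl

shiftL : ∀ {n} → Vec Bool n → Vec Bool n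
shiftL []       = []
shiftL (_ ∷ es) = es ∷ʳ false

∷ʳ-false-replicate : ∀ n → replicate n false ∷ʳ false ≡ replicate (suc n) false
∷ʳ-false-replicate zero    = refl
∷ʳ-false-replicate (suc n) = cong (false ∷_) (∷ʳ-false-replicate n)

shiftL-replicate : ∀ n → shiftL (replicate n false) ≡ replicate n false
shiftL-replicate zero    = refl
shiftL-replicate (suc n) = ∷ʳ-false-replicate n

shiftL-∷ʳ-false : ∀ {n} (e : Vec Bool n) → shiftL e ∷ʳ false ≡ shiftL (e ∷ʳ false)
shiftL-∷ʳ-false []      = refl
shiftL-∷ʳ-false (_ ∷ _) = refl

shiftL-nilpotent : ∀ {n} (e : Vec Bool n) → iterate shiftL e n ≡ replicate n false
shiftL-nilpotent []               = refl
shiftL-nilpotent {suc n} (_ ∷ es) = begin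
  iterate shiftL (es ∷ʳ false) n  ≡⟨ iterate-natural (_∷ʳ false) shiftL-∷ʳ-false n es ⟨
  iterate shiftL es n ∷ʳ false    ≡⟨ cong (_∷ʳ false) (shiftL-nilpotent es) ⟩
  replicate n false ∷ʳ false      ≡⟨ ∷ʳ-false-replicate n ⟩
  replicate (suc n) false         ∎
  where open ≡-Reasoning

isZeros : ∀ {n} → Vec Bool n → Bool
isZeros []          = true
isZeros (false ∷ e) = isZeros e
isZeros (true  ∷ _) = false

isZeros-replicate : ∀ n → isZeros (replicate n false) ≡ true
isZeros-replicate zero    = refl
isZeros-replicate (suc n) = isZeros-replicate n

isZeros⇒≡replicate : ∀ {n} (e : Vec Bool n) → isZeros e ≡ true → e ≡ replicate n false
isZeros⇒≡replicate []          _  = refl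
isZeros⇒≡replicate (false ∷ e) eq = cong (false ∷_) (isZeros⇒≡replicate e eq)

isZeros-∷ʳ-false : ∀ {n} (e : Vec Bool n) → isZeros (e ∷ʳ false) ≡ isZeros e
isZeros-∷ʳ-false []          = refl
isZeros-∷ʳ-false (false ∷ e) = isZeros-∷ʳ-false e
isZeros-∷ʳ-false (true  ∷ e) = refl

-- The vector w ++ 1 ∷ 0 ⋯ 0 of length m + 1; the address of a nonzero vector is the part before its
-- last 1.  The second clause is junk: it is only reached when length w > m.
encodeAddress : List Bool → (m : ℕ) → Vec Bool (suc m)
encodeAddress []ₗ      m       = true ∷ replicate m false
encodeAddress (_ ∷ₗ _) zero    = true ∷ []
encodeAddress (b ∷ₗ w) (suc m) = b ∷ encodeAddress w m

address : ∀ {m} → Vec Bool (suc m) → List Bool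
address {zero}  _        = []ₗ
address {suc m} (e ∷ es) = if isZeros es then []ₗ else e ∷ₗ address es

length-address : ∀ {m} (e : Vec Bool (suc m)) → length (address e) ≤ m
length-address {zero}  _        = z≤n
length-address {suc m} (e ∷ es) with isZeros es
... | true  = z≤n
... | false = s≤s (length-address es)

isZeros-encodeAddress : ∀ w m → isZeros (encodeAddress w m) ≡ false
isZeros-encodeAddress []ₗ          m       = refl
isZeros-encodeAddress (_     ∷ₗ _) zero    = refl
isZeros-encodeAddress (false ∷ₗ w) (suc m) = isZeros-encodeAddress w m
isZeros-encodeAddress (true  ∷ₗ w) (suc m) = refl

address-encodeAddress : ∀ w m → length w ≤ m → address (encodeAddress w m) ≡ w
address-encodeAddress []ₗ      zero    _       = refl
address-encodeAddress []ₗ      (suc m) _       rewrite isZeros-replicate m = refl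
address-encodeAddress (b ∷ₗ w) (suc m) (s≤s p) rewrite isZeros-encodeAddress w m
                                                     | address-encodeAddress w m p = refl

encodeAddress-address : ∀ {m} (e : Vec Bool (suc m)) → isZeros e ≡ false → encodeAddress (address e) m ≡ e
encodeAddress-address {zero}  (true ∷ []) _ = refl
encodeAddress-address {suc m} (e ∷ es) nz with isZeros es in eq
encodeAddress-address {suc m} (true  ∷ es) _  | true  = cong (true ∷_) (sym (isZeros⇒≡replicate es eq))
encodeAddress-address {suc m} (false ∷ es) nz | true  with () ← trans (sym eq) nz
encodeAddress-address {suc m} (e     ∷ es) _  | false = cong (e ∷_) (encodeAddress-address es eq)

encodeAddress-∷ʳ-false : ∀ w m → length w ≤ m → encodeAddress w m ∷ʳ false ≡ encodeAddress w (suc m)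
encodeAddress-∷ʳ-false []ₗ      m       _       = cong (true ∷_) (∷ʳ-false-replicate m)
encodeAddress-∷ʳ-false (b ∷ₗ w) (suc m) (s≤s p) = cong (b ∷_) (encodeAddress-∷ʳ-false w m p)

address-∷ʳ-false : ∀ {m} (e : Vec Bool (suc m)) → address (e ∷ʳ false) ≡ address e
address-∷ʳ-false {zero}  (_ ∷ []) = refl
address-∷ʳ-false {suc m} (e ∷ es) rewrite isZeros-∷ʳ-false es | address-∷ʳ-false es = refl

address-shiftL : ∀ {m} (e : Vec Bool (suc m)) → isZeros (shiftL e) ≡ false →
                 address e ≡ head e ∷ₗ address (shiftL e)
address-shiftL {zero}  (_ ∷ []) ()
address-shiftL {suc m} (e ∷ es) nz rewrite address-∷ʳ-false es | sym (isZeros-∷ʳ-false es) | nz = refl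

firstTwoSum : ∀ {k} → State (suc (suc k)) → Bool
firstTwoSum (a ∷ b ∷ _) = a xor b

defects : ∀ {k} → State (suc (suc k)) → Vec Bool k
defects {zero}  _       = []
defects {suc k} (a ∷ x) = (a xor firstTwoSum x) ∷ defects x

lastTwo : ∀ {k} → State (suc (suc k)) → Pair
lastTwo {zero}  (p ∷ q ∷ []) = p , q
lastTwo {suc k} (_ ∷ x)      = lastTwo x

build : ∀ {k} → Vec Bool k → Pair → State (suc (suc k))
build []       (p , q) = p ∷ q ∷ []
build (e ∷ es) c       = (e xor firstTwoSum (build es c)) ∷ build es c

defects-build : ∀ {k} (e : Vec Bool k) c → defects (build e c) ≡ e
defects-build []       c = refl
defects-build (e ∷ es) c = cong₂ _∷_ (xor-cancelʳ e _) (defects-build es c)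

lastTwo-build : ∀ {k} (e : Vec Bool k) c → lastTwo (build e c) ≡ c
lastTwo-build []       (p , q) = refl
lastTwo-build (e ∷ es) c       = lastTwo-build es c

build-defects-lastTwo : ∀ {k} (x : State (suc (suc k))) → build (defects x) (lastTwo x) ≡ x
build-defects-lastTwo {zero}  (p ∷ q ∷ []) = refl
build-defects-lastTwo {suc k} (a ∷ x) rewrite build-defects-lastTwo x = cong (_∷ x) (xor-cancelʳ a _)

coordinates-injective : ∀ {k} {x y : State (suc (suc k))} →
                        defects x ≡ defects y → lastTwo x ≡ lastTwo y → x ≡ y
coordinates-injective {x = x} {y} d l =
  trans (sym (build-defects-lastTwo x)) (trans (cong₂ build d l) (build-defects-lastTwo y))

build-zeroDefects : ∀ {k} (x : State (suc (suc k))) → defects x ≡ replicate k false →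
                    build (replicate k false) (lastTwo x) ≡ x
build-zeroDefects x dx = trans (cong (λ e → build e (lastTwo x)) (sym dx)) (build-defects-lastTwo x)

defects-∷ʳ-F : ∀ {k} (x : State (suc (suc k))) → defects (x ∷ʳ F x) ≡ defects x ∷ʳ false
defects-∷ʳ-F {zero}  (p ∷ q ∷ [])    = cong (_∷ []) (recurrence p q)
  where
    recurrence : ∀ p q → p xor (q xor (p xor q)) ≡ false
    recurrence false false = refl
    recurrence false true  = refl
    recurrence true  false = refl
    recurrence true  true  = refl
defects-∷ʳ-F {suc k} (a ∷ b ∷ c ∷ x) = cong ((a xor (b xor c)) ∷_) (defects-∷ʳ-F (b ∷ c ∷ x))

lastTwo-∷ʳ-F : ∀ {k} (x : State (suc (suc k))) → lastTwo (x ∷ʳ F x) ≡ fib (lastTwo x)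
lastTwo-∷ʳ-F {zero}  (p ∷ q ∷ [])    = refl
lastTwo-∷ʳ-F {suc k} (a ∷ b ∷ c ∷ x) = lastTwo-∷ʳ-F (b ∷ c ∷ x)

defects-next : ∀ {k} (x : State (suc (suc k))) → defects (next x) ≡ shiftL (defects x)
defects-next {zero}  (p ∷ q ∷ []) = refl
defects-next {suc k} (a ∷ x)      = defects-∷ʳ-F x

lastTwo-next : ∀ {k} (x : State (suc (suc k))) → lastTwo (next x) ≡ fib (lastTwo x)
lastTwo-next {zero}  (p ∷ q ∷ []) = refl
lastTwo-next {suc k} (a ∷ x)      = lastTwo-∷ʳ-F x

lastTwo-arc : ∀ {k} {x y : State (suc (suc k))} → Arc x y → lastTwo y ≡ fib (lastTwo x)
lastTwo-arc {x = x} refl = lastTwo-next x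

next-build : ∀ {k} (e : Vec Bool k) c → next (build e c) ≡ build (shiftL e) (fib c)
next-build e c = begin
  next (build e c)                                                 ≡⟨ build-defects-lastTwo _ ⟨
  build (defects (next (build e c))) (lastTwo (next (build e c)))
    ≡⟨ cong₂ build (trans (defects-next (build e c)) (cong shiftL (defects-build e c)))
                   (trans (lastTwo-next (build e c)) (cong fib (lastTwo-build e c))) ⟩
  build (shiftL e) (fib c)                                         ∎
  where open ≡-Reasoning

build-replicate-00 : ∀ {k} → build (replicate k false) (false , false) ≡ zeroState
build-replicate-00 {zero}  = refl
build-replicate-00 {suc k} rewrite build-replicate-00 {k} = refl

defects-zeroState : ∀ {k} → defects (zeroState {suc (suc k)}) ≡ replicate k false
defects-zeroState {k} = trans (cong defects (sym (build-replicate-00 {k}))) (defects-build (replicate k false) _)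

lastTwo-zeroState : ∀ {k} → lastTwo (zeroState {suc (suc k)}) ≡ (false , false)
lastTwo-zeroState {k} = trans (cong lastTwo (sym (build-replicate-00 {k}))) (lastTwo-build (replicate k false) _)

next-zeroState : ∀ k → next (zeroState {suc (suc k)}) ≡ zeroState
next-zeroState zero    = refl
next-zeroState (suc k) = cong (false ∷_) (next-zeroState k)

next-v₁ : ∀ k → next (v₁ {suc (suc k)}) ≡ v₂
next-v₁ 0 = refl
next-v₁ 1 = refl
next-v₁ 2 = refl
next-v₁ (suc (suc (suc k))) = cong (λ z → true ∷ true ∷ false ∷ z) (next-v₁ k)

next-v₂ : ∀ k → next (v₂ {suc (suc k)}) ≡ v₃
next-v₂ 0 = refl
next-v₂ 1 = refl
next-v₂ 2 = refl
next-v₂ (suc (suc (suc k))) = cong (λ z → true ∷ false ∷ true ∷ z) (next-v₂ k)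

next-v₃ : ∀ k → next (v₃ {suc (suc k)}) ≡ v₁
next-v₃ 0 = refl
next-v₃ 1 = refl
next-v₃ 2 = refl
next-v₃ (suc (suc (suc k))) = cong (λ z → false ∷ true ∷ true ∷ z) (next-v₃ k)

defects-v₁ : ∀ k → defects (v₁ {suc (suc k)}) ≡ replicate k false
defects-v₁ 0 = refl
defects-v₁ 1 = refl
defects-v₁ 2 = refl
defects-v₁ (suc (suc (suc k))) = cong (λ z → false ∷ false ∷ false ∷ z) (defects-v₁ k)

zeroDefects-arc : ∀ {k} {x y : State (suc (suc k))} →
                  Arc x y → defects x ≡ replicate k false → defects y ≡ replicate k false
zeroDefects-arc {k} {x} refl dx = trans (defects-next x) (trans (cong shiftL dx) (shiftL-replicate k))

defects-v₂ : ∀ k → defects (v₂ {suc (suc k)}) ≡ replicate k false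
defects-v₂ k = zeroDefects-arc (next-v₁ k) (defects-v₁ k)

defects-v₃ : ∀ k → defects (v₃ {suc (suc k)}) ≡ replicate k false
defects-v₃ k = zeroDefects-arc (next-v₂ k) (defects-v₂ k)

v₁≢zeroState : ∀ {k} → v₁ {suc (suc k)} ≢ zeroState
v₁≢zeroState eq with cong (λ v → lookup v (fsuc fzero)) eq
... | ()

isZero-lastTwo-v₁ : ∀ k → isZero (lastTwo (v₁ {suc (suc k)})) ≡ false
isZero-lastTwo-v₁ k with isZero (lastTwo (v₁ {suc (suc k)})) in eq
... | false = refl
... | true  = ⊥-elim (v₁≢zeroState {k} (begin
  v₁                                         ≡⟨ build-zeroDefects v₁ (defects-v₁ k) ⟨
  build (replicate k false) (lastTwo (v₁ {suc (suc k)}))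
                                             ≡⟨ cong (build (replicate k false)) (isZero⇒≡00 eq) ⟩
  build (replicate k false) (false , false)  ≡⟨ build-replicate-00 ⟩
  zeroState                                  ∎))
  where open ≡-Reasoning

zeroDefects-cycle : ∀ {k} {c} → isZero c ≡ false →
                    let x = build (replicate k false) c in x ≡ v₁ ⊎ x ≡ v₂ ⊎ x ≡ v₃
zeroDefects-cycle {k} nz with fib-orbit (isZero-lastTwo-v₁ k) nz
... | inj₁ refl        = inj₁ (build-zeroDefects v₁ (defects-v₁ k))
... | inj₂ (inj₁ refl) = inj₂ (inj₁ (subst (λ c → build (replicate k false) c ≡ v₂) (lastTwo-arc (next-v₁ k))
                                       (build-zeroDefects v₂ (defects-v₂ k))))
... | inj₂ (inj₂ refl) = inj₂ (inj₂ (subst (λ c → build (replicate k false) c ≡ v₃)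
                                       (trans (lastTwo-arc (next-v₂ k)) (cong fib (lastTwo-arc (next-v₁ k))))
                                       (build-zeroDefects v₃ (defects-v₃ k))))

isZero-lastTwo-invariant : ∀ {k} {x y : State (suc (suc k))} → Connected x y → isZero (lastTwo x) ≡ isZero (lastTwo y)
isZero-lastTwo-invariant = EqClosure.gfold isEquivalence (isZero ∘ lastTwo) isZero-lastTwo-arc
  where
    isZero-lastTwo-arc : ∀ {k} {x y : State (suc (suc k))} → Arc x y → isZero (lastTwo x) ≡ isZero (lastTwo y)
    isZero-lastTwo-arc {x = x} a = sym (trans (cong isZero (lastTwo-arc a)) (isZero-fib (lastTwo x)))

arc⇒connected : ∀ {k} {x y : State (suc (suc k))} → Arc x y → Connected x y
arc⇒connected a = fwd a ◅ ε

connected-iterate-next : ∀ {k} n (x : State (suc (suc k))) → Connected x (iterate next x n)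
connected-iterate-next zero    x = ε
connected-iterate-next (suc n) x = arc⇒connected refl ◅◅ connected-iterate-next n (next x)

connected-zeroDefects : ∀ {k} (x : State (suc (suc k))) →
                        Σ Pair λ c → isZero c ≡ isZero (lastTwo x) × Connected x (build (replicate k false) c)
connected-zeroDefects {k} x = lastTwo xₖ , isZero-lastTwo-xₖ , subst (Connected x) (sym xₖ-on-cycle) x~xₖ
  where
    xₖ = iterate next x k
    x~xₖ : Connected x xₖ
    x~xₖ = connected-iterate-next k x
    xₖ-on-cycle : build (replicate k false) (lastTwo xₖ) ≡ xₖ
    xₖ-on-cycle = build-zeroDefects xₖ
      (trans (iterate-natural defects defects-next k x) (shiftL-nilpotent (defects x)))
    isZero-lastTwo-xₖ : isZero (lastTwo xₖ) ≡ isZero (lastTwo x)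
    isZero-lastTwo-xₖ = sym (isZero-lastTwo-invariant x~xₖ)

connected-zeroState : ∀ {k} (x : State (suc (suc k))) → isZero (lastTwo x) ≡ true → Connected x zeroState
connected-zeroState {k} x z with connected-zeroDefects x
... | c , isZero-c , x~c = subst (Connected x) c-is-zeroState x~c
  where
    c-is-zeroState : build (replicate k false) c ≡ zeroState
    c-is-zeroState = trans (cong (build (replicate k false)) (isZero⇒≡00 (trans isZero-c z))) build-replicate-00

cycle-connected : ∀ {k} {y : State (suc (suc k))} → y ≡ v₁ ⊎ y ≡ v₂ ⊎ y ≡ v₃ → Connected y v₁
cycle-connected     (inj₁ refl)        = ε
cycle-connected {k} (inj₂ (inj₁ refl)) = bwd (next-v₁ k) ◅ ε
cycle-connected {k} (inj₂ (inj₂ refl)) = arc⇒connected (next-v₃ k)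

connected-v₁ : ∀ {k} (x : State (suc (suc k))) → isZero (lastTwo x) ≡ false → Connected x v₁
connected-v₁ x nz with connected-zeroDefects x
... | c , isZero-c , x~c = x~c ◅◅ cycle-connected (zeroDefects-cycle (trans isZero-c nz))

connected-zeroState-or-v₁ : ∀ {k} (x : State (suc (suc k))) → Connected x zeroState ⊎ Connected x v₁
connected-zeroState-or-v₁ x with isZero (lastTwo x) in eq
... | true  = inj₁ (connected-zeroState x eq)
... | false = inj₂ (connected-v₁ x eq)

lastTwo-G₁ : ∀ {k} {x : State (suc (suc k))} → Connected x zeroState → lastTwo x ≡ (false , false)
lastTwo-G₁ {k} x~0 = isZero⇒≡00 (trans (isZero-lastTwo-invariant x~0) (cong isZero (lastTwo-zeroState {k})))

isZero-lastTwo-G₂ : ∀ {k} {x : State (suc (suc k))} → Connected x v₁ → isZero (lastTwo x) ≡ false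
isZero-lastTwo-G₂ {k} x~v₁ = trans (isZero-lastTwo-invariant x~v₁) (isZero-lastTwo-v₁ k)

zeroState≁v₁ : ∀ {k} → ¬ Connected (zeroState {suc (suc k)}) v₁
zeroState≁v₁ {k} 0~v₁ with () ← trans (sym (cong isZero (lastTwo-zeroState {k}))) (isZero-lastTwo-G₂ 0~v₁)

isZeros⇒zeroDefects : ∀ {k} (x : State (suc (suc k))) → isZeros (defects x) ≡ true →
                      x ≡ build (replicate k false) (lastTwo x)
isZeros⇒zeroDefects x eq = sym (build-zeroDefects x (isZeros⇒≡replicate (defects x) eq))

nonzeroDefects-G₁ : ∀ {k} (x : State (suc (suc k))) → lastTwo x ≡ (false , false) → x ≢ zeroState →
                    isZeros (defects x) ≡ false
nonzeroDefects-G₁ {k} x l x≢0 with isZeros (defects x) in eq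
... | false = refl
... | true  = ⊥-elim (x≢0 (begin
  x                                          ≡⟨ isZeros⇒zeroDefects x eq ⟩
  build (replicate k false) (lastTwo x)      ≡⟨ cong (build (replicate k false)) l ⟩
  build (replicate k false) (false , false)  ≡⟨ build-replicate-00 ⟩
  zeroState                                  ∎))
  where open ≡-Reasoning

nonzeroDefects-G₂ : ∀ {k} (x : State (suc (suc k))) → isZero (lastTwo x) ≡ false →
                    x ≢ v₁ → x ≢ v₂ → x ≢ v₃ → isZeros (defects x) ≡ false
nonzeroDefects-G₂ {k} x nz x≢v₁ x≢v₂ x≢v₃ with isZeros (defects x) in eq
... | false = refl
... | true  with zeroDefects-cycle {k} nz | isZeros⇒zeroDefects x eq
...   | inj₁ e        | x≡ = ⊥-elim (x≢v₁ (trans x≡ e))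
...   | inj₂ (inj₁ e) | x≡ = ⊥-elim (x≢v₂ (trans x≡ e))
...   | inj₂ (inj₂ e) | x≡ = ⊥-elim (x≢v₃ (trans x≡ e))

module _ {m : ℕ} where

  treeVertex : State (suc (suc (suc m))) → TVert m
  treeVertex x = address (defects x) , length-address (defects x)

  atAddress : List Bool → Pair → State (suc (suc (suc m)))
  atAddress w c = build (encodeAddress w m) c

  -- The last two entries of the root of x's tree, which x reaches in length (address (defects x)) steps.
  rootPair : State (suc (suc (suc m))) → Pair
  rootPair x = iterate fib (lastTwo x) (length (address (defects x)))

  TVert-≡ : ∀ {u v : TVert m} → proj₁ u ≡ proj₁ v → u ≡ v
  TVert-≡ {w , p} {.w , q} refl = cong (w ,_) (≤-irrelevant p q)

  treeVertex-atAddress : ∀ w c (p : length w ≤ m) → treeVertex (atAddress w c) ≡ (w , p)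
  treeVertex-atAddress w c p =
    TVert-≡ (trans (cong address (defects-build (encodeAddress w m) c)) (address-encodeAddress w m p))

  atAddress-treeVertex : ∀ x → isZeros (defects x) ≡ false → atAddress (address (defects x)) (lastTwo x) ≡ x
  atAddress-treeVertex x nz = coordinates-injective
    (trans (defects-build _ _) (encodeAddress-address (defects x) nz))
    (lastTwo-build (encodeAddress (address (defects x)) m) _)

  atAddress-≢ : ∀ w c y → defects y ≡ replicate (suc m) false → atAddress w c ≢ y
  atAddress-≢ w c y dy eq = false≢true (begin
    false                              ≡⟨ isZeros-encodeAddress w m ⟨
    isZeros (encodeAddress w m)        ≡⟨ cong isZeros (defects-build (encodeAddress w m) c) ⟨
    isZeros (defects (atAddress w c))  ≡⟨ cong (isZeros ∘ defects) eq ⟩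
    isZeros (defects y)                ≡⟨ cong isZeros dy ⟩
    isZeros (replicate (suc m) false)  ≡⟨ isZeros-replicate (suc m) ⟩
    true                               ∎)
    where
      open ≡-Reasoning
      false≢true : false ≢ true
      false≢true ()

  address-arc : ∀ {x y : State (suc (suc (suc m)))} → Arc x y → isZeros (defects y) ≡ false →
                address (defects x) ≡ head (defects x) ∷ₗ address (defects y)
  address-arc {x} refl nz rewrite defects-next x = address-shiftL (defects x) nz

  rootPair-arc : ∀ {x y : State (suc (suc (suc m)))} → Arc x y → isZeros (defects y) ≡ false →
                 rootPair x ≡ rootPair y
  rootPair-arc {x} {y} a nz = begin
    iterate fib (lastTwo x) (length (address (defects x)))
      ≡⟨ cong (iterate fib (lastTwo x) ∘ length) (address-arc a nz) ⟩
    iterate fib (fib (lastTwo x)) (length (address (defects y)))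
      ≡⟨ cong (λ c → iterate fib c (length (address (defects y)))) (lastTwo-arc {x = x} a) ⟨
    rootPair y
      ∎
    where open ≡-Reasoning

  rootPair-atAddress : ∀ w c (p : length w ≤ m) → rootPair (atAddress w (iterate fib⁻¹ c (length w))) ≡ c
  rootPair-atAddress w c p = begin
    iterate fib (lastTwo x) (length (address (defects x)))
      ≡⟨ cong (iterate fib (lastTwo x) ∘ length ∘ proj₁) (treeVertex-atAddress w c′ p) ⟩
    iterate fib (lastTwo x) (length w)
      ≡⟨ cong (λ d → iterate fib d (length w)) (lastTwo-build (encodeAddress w m) c′) ⟩
    iterate fib c′ (length w)
      ≡⟨ iterate-inverse fib³≡id fib³≡id (length w) c ⟩
    c ∎
    where
      open ≡-Reasoning
      c′ = iterate fib⁻¹ c (length w)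
      x = atAddress w c′

next-atAddress : ∀ {m} b w c → suc (length w) ≤ m → next (atAddress {m} (b ∷ₗ w) c) ≡ atAddress w (fib c)
next-atAddress {suc m} b w c (s≤s p) =
  trans (next-build (encodeAddress (b ∷ₗ w) (suc m)) c)
        (cong (λ e → build e (fib c)) (encodeAddress-∷ʳ-false w m p))

module _ (m : ℕ) where

  G₁-tree : IsPerfectBinaryTree {suc m} (λ x → Connected x zeroState × x ≢ zeroState) m
  G₁-tree = record
    { to       = λ x _ → treeVertex x
    ; from     = from
    ; from-P   = λ (w , _) → connected-zeroState _ (cong isZero (lastTwo-build (encodeAddress w m) _))
                           , atAddress-≢ w _ zeroState defects-zeroState
    ; from-to  = λ x (x~0 , x≢0) → trans (cong (atAddress _) (sym (lastTwo-G₁ x~0)))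
                                         (atAddress-treeVertex x (nonzeroDefects-G₁ x (lastTwo-G₁ x~0) x≢0))
    ; to-from  = λ (w , p) _ → treeVertex-atAddress w _ p
    ; to-arc   = λ x y _ (y~0 , y≢0) a →
                   head (defects x) , address-arc a (nonzeroDefects-G₁ y (lastTwo-G₁ y~0) y≢0)
    ; from-arc = from-arc
    }
    where
      from : TVert m → State (suc (suc (suc m)))
      from (w , _) = atAddress w (false , false)
      from-arc : ∀ u v → TArc u v → Arc (from u) (from v)
      from-arc (_ , p) (w , _) (b , refl) = next-atAddress b w _ p

  G₂-trees : IsThreePerfectBinaryTrees {suc m} (λ x → Connected x v₁ × x ≢ v₁ × x ≢ v₂ × x ≢ v₃) m
  G₂-trees = record
    { to       = λ x _ → cycleIndex (rootPair x) , treeVertex x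
    ; from     = from
    ; from-P   = λ (i , (w , _)) →
                   connected-v₁ _ (isZero-lastTwo-from i w) , atAddress-≢ w _ v₁ (defects-v₁ (suc m))
                   , atAddress-≢ w _ v₂ (defects-v₂ (suc m)) , atAddress-≢ w _ v₃ (defects-v₃ (suc m))
    ; from-to  = from-to
    ; to-from  = λ (i , (w , p)) _ →
                   cong₂ _,_ (trans (cong cycleIndex (rootPair-atAddress w _ p)) (cycleIndex-cyclePair i))
                             (treeVertex-atAddress w _ p)
    ; to-arc   = λ x y _ py a → cong cycleIndex (rootPair-arc a (nonzeroDefects y py))
                              , head (defects x) , address-arc a (nonzeroDefects y py)
    ; from-arc = from-arc
    }
    where
      G₂∖cycle : State (suc (suc (suc m))) → Set
      G₂∖cycle x = Connected x v₁ × x ≢ v₁ × x ≢ v₂ × x ≢ v₃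

      from : Forest3 m → State (suc (suc (suc m)))
      from (i , (w , _)) = atAddress w (iterate fib⁻¹ (cyclePair i) (length w))

      isZero-lastTwo-from : ∀ i w → isZero (lastTwo (atAddress {m} w (iterate fib⁻¹ (cyclePair i) (length w)))) ≡ false
      isZero-lastTwo-from i w = begin
        isZero (lastTwo (atAddress {m} w c))        ≡⟨ cong isZero (lastTwo-build (encodeAddress w m) c) ⟩
        isZero c                                    ≡⟨ iterate-invariant isZero isZero-fib⁻¹ (length w) (cyclePair i) ⟩
        isZero (cyclePair i)                        ≡⟨ isZero-cyclePair i ⟩
        false                                       ∎
        where
          open ≡-Reasoning
          c = iterate fib⁻¹ (cyclePair i) (length w)

      nonzeroDefects : ∀ x → G₂∖cycle x → isZeros (defects x) ≡ false
      nonzeroDefects x (x~v₁ , x≢v₁ , x≢v₂ , x≢v₃) = nonzeroDefects-G₂ x (isZero-lastTwo-G₂ x~v₁) x≢v₁ x≢v₂ x≢v₃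

      from-to : ∀ x → G₂∖cycle x → from (cycleIndex (rootPair x) , treeVertex x) ≡ x
      from-to x px = begin
        atAddress w (iterate fib⁻¹ (cyclePair (cycleIndex (rootPair x))) L)
          ≡⟨ cong (λ c → atAddress w (iterate fib⁻¹ c L)) (cyclePair-cycleIndex (rootPair x) isZero-rootPair) ⟩
        atAddress w (iterate fib⁻¹ (iterate fib (lastTwo x) L) L)
          ≡⟨ cong (atAddress w) (iterate-inverse fib³≡id fib³≡id L (lastTwo x)) ⟩
        atAddress w (lastTwo x)
          ≡⟨ atAddress-treeVertex x (nonzeroDefects x px) ⟩
        x ∎
        where
          open ≡-Reasoning
          w = address (defects x)
          L = length w
          isZero-rootPair : isZero (rootPair x) ≡ false
          isZero-rootPair = trans (iterate-invariant isZero isZero-fib L (lastTwo x)) (isZero-lastTwo-G₂ (proj₁ px))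

      from-arc : ∀ u v → FArc u v → Arc (from u) (from v)
      from-arc (i , (_ , p)) (.i , (w , _)) (refl , (b , refl)) =
        trans (next-atAddress b w _ p) (cong (atAddress w) (fib-iterate-fib⁻¹ (length w) (cyclePair i)))

theorem4 : (m : ℕ) →
    -- the loop at 0ⁿ and the 3-cycle v₁ → v₂ → v₃ → v₁
    (next {suc m} zeroState ≡ zeroState) ×
    (next {suc m} v₁ ≡ v₂) × (next {suc m} v₂ ≡ v₃) × (next {suc m} v₃ ≡ v₁) ×
    -- exactly two connected components: G₁ ∋ 0ⁿ and G₂ ∋ v₁
    (∀ x → Connected {suc m} x zeroState ⊎ Connected {suc m} x v₁) ×
    ¬ Connected {suc m} zeroState v₁ ×
    -- G₁ ∖ [0] is a perfect binary directed tree of depth n - 3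
    IsPerfectBinaryTree {suc m} (λ x → Connected x zeroState × x ≢ zeroState) m ×
    -- G₂ ∖ [0,1,1] consists of three perfect binary directed trees of depth n - 3
    IsThreePerfectBinaryTrees {suc m}
      (λ x → Connected x v₁ × x ≢ v₁ × x ≢ v₂ × x ≢ v₃) m
theorem4 m = next-zeroState (suc m) , next-v₁ (suc m) , next-v₂ (suc m) , next-v₃ (suc m)
           , connected-zeroState-or-v₁ , zeroState≁v₁ , G₁-tree m , G₂-trees m
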